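{- For every positive integer $\ell$ there exists a tree $T$ such that $\gamma_t(T)-\chi_{\mu_2}(T)=\ell$.
   Context: All graphs are finite, simple and undirected. A $u,v$-geodesic is a shortest $u,v$-path. A set $M\subseteq V(G)$ is a $2$-distance mutual-visibility set if for every two distinct $u,v\in M$ there is a $u,v$-geodesic of length at most $2$ none of whose internal vertices lies in $M$. $\chi_{\mu_2}(G)$ is the minimum number of parts in a partition of $V(G)$ into $2$-distance mutual-visibility sets. $\gamma_t(G)$ is the total domination number: the minimum size of a set $D\subseteq V(G)$ such that every vertex of $G$ has a neighbor in $D$. -}

module Defs where

open import Data.Nat using (ℕ; zero; suc; _≤_; _+_)
open import Data.Fin using (Fin)
open import Data.Fin.Subset using (Subset; _∈_; ∣_∣)
open import Data.Bool using (Bool; T; false)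
open import Data.List using (List; []; _∷_)
open import Data.List.Relation.Unary.All using (All)
open import Data.List.Relation.Unary.Unique.Propositional using (Unique)
open import Data.Product using (Σ; ∃; _×_; _,_)
open import Relation.Nullary using (¬_)
open import Data.Empty using (⊥)
open import Relation.Binary.PropositionalEquality using (_≡_; _≢_)

record Graph (n : ℕ) : Set where
  field
    adj    : Fin n → Fin n → Bool
    sym    : ∀ u v → adj u v ≡ adj v u
    irrefl : ∀ u → adj u u ≡ false
open Graph public

Adj : ∀ {n} → Graph n → Fin n → Fin n → Set
Adj G u v = T (adj G u v)

data Walk {n : ℕ} (G : Graph n) : Fin n → Fin n → Set where
  []  : ∀ {u} → Walk G u u
  _∷_ : ∀ {u w v} → Adj G u w → Walk G w v → Walk G u v

len : ∀ {n} {G : Graph n} {u v} → Walk G u v → ℕ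
len []      = 0
len (_ ∷ p) = suc (len p)

verts : ∀ {n} {G : Graph n} {u v} → Walk G u v → List (Fin n)
verts {u = u} []      = u ∷ []
verts {u = u} (_ ∷ p) = u ∷ verts p

inner : ∀ {n} {G : Graph n} {u v} → Walk G u v → List (Fin n)
inner []                       = []
inner (_ ∷ [])                 = []
inner (_∷_ {w = w} _ (a ∷ p))  = w ∷ inner (a ∷ p)

IsGeodesic : ∀ {n} {G : Graph n} {u v} → Walk G u v → Set
IsGeodesic {G = G} {u} {v} p = ∀ (q : Walk G u v) → len p ≤ len q

Connected : ∀ {n} → Graph n → Set
Connected {n} G = ∀ (u v : Fin n) → Walk G u v

-- a cycle: closed walk of length ≥ 3 whose vertices (the start counted once) are distinct
IsCycle : ∀ {n} {G : Graph n} {u} → Walk G u u → Set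
IsCycle []      = ⊥
IsCycle (a ∷ p) = (3 ≤ len (a ∷ p)) × Unique (verts p)

Acyclic : ∀ {n} → Graph n → Set
Acyclic {n} G = ∀ (u : Fin n) (p : Walk G u u) → ¬ IsCycle p

IsTree : ∀ {n} → Graph n → Set
IsTree {n} G = (1 ≤ n) × Connected G × Acyclic G

IsMV2 : ∀ {n} → Graph n → (Fin n → Set) → Set
IsMV2 {n} G M =
  ∀ (u v : Fin n) → M u → M v → u ≢ v →
    Σ (Walk G u v) λ p → IsGeodesic p × (len p ≤ 2) × All (λ x → ¬ M x) (inner p)

-- partition of V(G) into (at most) k 2-distance mutual-visibility sets, given by a map to part labels
MV2Partition : ∀ {n} → Graph n → ℕ → Set
MV2Partition {n} G k = Σ (Fin n → Fin k) λ f → ∀ (i : Fin k) → IsMV2 G (λ x → f x ≡ i)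

IsChiMu2 : ∀ {n} → Graph n → ℕ → Set
IsChiMu2 G k = MV2Partition G k × (∀ m → MV2Partition G m → k ≤ m)

TotalDominating : ∀ {n} → Graph n → Subset n → Set
TotalDominating {n} G D = ∀ (v : Fin n) → ∃ λ u → u ∈ D × Adj G v u

IsTotalDomNum : ∀ {n} → Graph n → ℕ → Set
IsTotalDomNum {n} G g =
  (Σ (Subset n) λ D → TotalDominating G D × ∣ D ∣ ≡ g)
  × (∀ (D : Subset n) → TotalDominating G D → g ≤ ∣ D ∣)

-- For k = ℓ take the tree with root c, a pendant leaf a, k pendant paths c b j b′ j and k pendant paths
-- c d j d′ j d″ j. Its 1 + 3k internal vertices dominate totally, and giving every internal vertex a
-- private child (a, b′ j, d′ j, d″ j) yields an open packing of the same size, so γₜ = 1 + 3k.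
-- Its 1 + 2k leaves have pairwise distinct parents, so their closed neighbourhoods are disjoint
-- and no two of them are joined by a walk of length at most 2: they need distinct parts, so
-- χ_μ₂ ≥ 1 + 2k. The parts {children of c}, {c, b′ j₀}, {b′ j} (j ≢ j₀) and {d′ j, d″ j} attain it.
module Submission where

open import Defs hiding (sym)
open import Data.Bool using (T)
open import Data.Bool.Properties using (∨-comm)
open import Data.Empty using (⊥-elim)
open import Data.Fin using (Fin; zero; suc; _↑ˡ_; _≟_)
open import Data.Fin.Properties using (injective⇒≤; +↔⊎; *↔×; nonZeroIndex) renaming (suc-injective to suc-injectiveᶠ)
open import Data.Fin.Subset using (Subset; inside; outside; ∣_∣; _∈_) renaming (⊤ to full; ⊥ to empty)
open import Data.Fin.Subset.Properties using (∣⊥∣≡0)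
open import Data.List using (_∷_)
open import Data.List.Membership.Propositional using () renaming (_∈_ to _∈ˡ_)
open import Data.List.Relation.Unary.All as All using (All; []; _∷_)
open import Data.List.Relation.Unary.AllPairs using (_∷_)
open import Data.List.Relation.Unary.Any using (here; there)
open import Data.List.Relation.Unary.Unique.Propositional using (Unique)
open import Data.Nat as ℕ using (ℕ; zero; suc; _+_; _*_; _≤_; _<_; z≤n; s≤s; >-nonZero⁻¹)
open import Data.Nat.Properties using (≤-refl; ≤-trans; <-trans; <-irrefl; ≤-reflexive; n≤1+n; 1+n≰n; 1+n≢n; suc-injective; +-comm)
open import Data.Product using (Σ; ∃; _×_; _,_; proj₁; proj₂)
open import Data.Sum using (_⊎_; inj₁; inj₂)
open import Data.Sum.Function.Propositional using (_⊎-↔_)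
open import Data.Unit using (⊤; tt)
open import Data.Vec using (_∷_; _++_; here; there)
open import Function using (_∘_)
open import Function.Bundles using (_↔_; Inverse; Injection)
open import Function.Definitions using (Injective)
open import Function.Properties.Inverse using (↔-refl; ↔-trans; ↔-sym; ↔⇒↣)
open import Relation.Binary.Definitions using (DecidableEquality)
open import Relation.Binary.PropositionalEquality using (_≡_; _≢_; refl; sym; trans; cong; subst; subst₂; ≢-sym)
open import Relation.Nullary using (¬_; Dec; yes; no; does; contradiction; _×-dec_; _⊎-dec_)
open import Relation.Nullary.Decidable using (toWitness; fromWitness; isYes≗does; dec-false; via-injection)

module _ {n : ℕ} {G : Graph n} where

  adj-sym : ∀ {u v} → Adj G u v → Adj G v u
  adj-sym {u} {v} = subst T (Graph.sym G u v)

  adj⇒≢ : ∀ {u v} → Adj G u v → u ≢ v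
  adj⇒≢ {u} e refl = subst T (Graph.irrefl G u) e

  _++ʷ_ : ∀ {u v w} → Walk G u v → Walk G v w → Walk G u w
  []      ++ʷ q = q
  (e ∷ p) ++ʷ q = e ∷ (p ++ʷ q)

  reverseʷ : ∀ {u v} → Walk G u v → Walk G v u
  reverseʷ []      = []
  reverseʷ (e ∷ p) = reverseʷ p ++ʷ (adj-sym e ∷ [])

  last∈verts : ∀ {u v} (p : Walk G u v) → v ∈ˡ verts p
  last∈verts []      = here refl
  last∈verts (_ ∷ p) = there (last∈verts p)

  edge-isGeodesic : ∀ {u v} (e : Adj G u v) → IsGeodesic {G = G} (e ∷ [])
  edge-isGeodesic e []      = ⊥-elim (adj⇒≢ e refl)
  edge-isGeodesic e (_ ∷ _) = s≤s z≤n

  twoStep-isGeodesic : ∀ {u w v} → u ≢ v → ¬ Adj G u v →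
                       (e : Adj G u w) (f : Adj G w v) → IsGeodesic {G = G} (e ∷ f ∷ [])
  twoStep-isGeodesic u≢v _   _ _ []          = ⊥-elim (u≢v refl)
  twoStep-isGeodesic _   u≁v _ _ (g ∷ [])    = ⊥-elim (u≁v g)
  twoStep-isGeodesic _   _   _ _ (_ ∷ _ ∷ _) = s≤s (s≤s z≤n)

rank : ∀ {n} {p : Subset n} {x} → x ∈ p → Fin ∣ p ∣
rank {p = inside  ∷ _} here        = zero
rank {p = inside  ∷ _} (there x∈p) = suc (rank x∈p)
rank {p = outside ∷ _} (there x∈p) = rank x∈p

rank-injective : ∀ {n} {p : Subset n} {x y} (x∈p : x ∈ p) (y∈p : y ∈ p) → rank x∈p ≡ rank y∈p → x ≡ y
rank-injective {p = inside  ∷ _} here        here        _  = refl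
rank-injective {p = inside  ∷ _} (there x∈p) (there y∈p) eq = cong suc (rank-injective x∈p y∈p (suc-injectiveᶠ eq))
rank-injective {p = outside ∷ _} (there x∈p) (there y∈p) eq = cong suc (rank-injective x∈p y∈p eq)

injective⇒≤∣p∣ : ∀ {m n} {p : Subset n} (g : Fin m → Fin n) → Injective _≡_ _≡_ g → (∀ i → g i ∈ p) → m ≤ ∣ p ∣
injective⇒≤∣p∣ g g-injective g∈p = injective⇒≤ (g-injective ∘ rank-injective (g∈p _) (g∈p _))

∣full++empty∣ : ∀ m n → ∣ full {m} ++ empty {n} ∣ ≡ m
∣full++empty∣ zero    n = ∣⊥∣≡0 n
∣full++empty∣ (suc m) n = cong suc (∣full++empty∣ m n)

↑ˡ∈full++empty : ∀ {m} n (i : Fin m) → i ↑ˡ n ∈ full {m} ++ empty {n}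
↑ˡ∈full++empty n zero    = here
↑ˡ∈full++empty n (suc i) = there (↑ˡ∈full++empty n i)

module _ {n : ℕ} (G : Graph n) where

  ClosedNbr : Fin n → Fin n → Set
  ClosedNbr u z = u ≡ z ⊎ Adj G u z

  Packing : {A : Set} → (A → Fin n) → Set
  Packing w = ∀ {x y} z → ClosedNbr (w x) z → ClosedNbr (w y) z → x ≡ y

  OpenPacking : {A : Set} → (A → Fin n) → Set
  OpenPacking w = ∀ {x y} z → Adj G (w x) z → Adj G (w y) z → x ≡ y

  short-walk⇒common-closedNbr : ∀ {u v} (p : Walk G u v) → len p ≤ 2 → ∃ λ z → ClosedNbr u z × ClosedNbr v z
  short-walk⇒common-closedNbr {u} []                        _ = u , inj₁ refl , inj₁ refl
  short-walk⇒common-closedNbr {v = v} (e ∷ [])              _ = v , inj₂ e , inj₁ refl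
  short-walk⇒common-closedNbr (_∷_ {w = w} e (f ∷ []))      _ = w , inj₂ e , inj₂ (adj-sym {G = G} f)
  short-walk⇒common-closedNbr (_ ∷ _ ∷ _ ∷ _) (s≤s (s≤s ()))

  packing-size≤parts : ∀ {m k} {A : Set} → Fin m ↔ A → (w : A → Fin n) → Packing w → MV2Partition G k → m ≤ k
  packing-size≤parts ι w packing (colour , visible) =
    injective⇒≤ (Injection.injective (↔⇒↣ ι) ∘ sameColour⇒≡)
    where
    sameColour⇒≡ : ∀ {x y} → colour (w x) ≡ colour (w y) → x ≡ y
    sameColour⇒≡ {x} {y} eq with w x ≟ w y
    ... | yes wx≡wy = packing (w y) (inj₁ wx≡wy) (inj₁ refl)
    ... | no wx≢wy with visible (colour (w y)) (w x) (w y) eq refl wx≢wy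
    ...   | p , _ , short , _ with short-walk⇒common-closedNbr p short
    ...     | z , x∼z , y∼z = packing z x∼z y∼z

  openPacking-size≤∣D∣ : ∀ {m} {A : Set} → Fin m ↔ A → (w : A → Fin n) → OpenPacking w →
                         ∀ D → TotalDominating G D → m ≤ ∣ D ∣
  openPacking-size≤∣D∣ {m} ι w packing D dominating =
    injective⇒≤∣p∣ dominator (Injection.injective (↔⇒↣ ι) ∘ sameDominator⇒≡) (proj₁ ∘ proj₂ ∘ dominating ∘ w′)
    where
    w′ : Fin m → Fin n
    w′ = w ∘ Inverse.to ι
    dominator : Fin m → Fin n
    dominator = proj₁ ∘ dominating ∘ w′
    sameDominator⇒≡ : ∀ {i j} → dominator i ≡ dominator j → Inverse.to ι i ≡ Inverse.to ι j
    sameDominator⇒≡ {i} {j} eq =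
      packing (dominator i) (proj₂ (proj₂ (dominating (w′ i))))
              (subst (Adj G (w′ j)) (sym eq) (proj₂ (proj₂ (dominating (w′ j)))))

module ParentAcyclic {n : ℕ} {G : Graph n} (parent : Fin n → Fin n) (depth : Fin n → ℕ)
  (edge : ∀ {u v} → Adj G u v →
          (parent u ≡ v × depth u ≡ suc (depth v)) ⊎ (parent v ≡ u × depth v ≡ suc (depth u)))
  where

  ChildOf : Fin n → Fin n → Set
  ChildOf u v = parent u ≡ v × depth u ≡ suc (depth v)

  penultimate : ∀ {u v} → Fin n → Walk G u v → Fin n
  penultimate x []                  = x
  penultimate _ (_∷_ {u = u} _ p)   = penultimate u p

  penultimate∈ : ∀ {u v} x (p : Walk G u v) → penultimate x p ∈ˡ x ∷ verts p
  penultimate∈ x []      = here refl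
  penultimate∈ x (_ ∷ p) = there (penultimate∈ _ p)

  FirstStepAvoids : ∀ {u v} → Fin n → Walk G u v → Set
  FirstStepAvoids x []                  = ⊤
  FirstStepAvoids x (_∷_ {w = w} _ _)   = w ≢ x

  firstStepAvoids : ∀ {x u v} (p : Walk G u v) → All (x ≢_) (verts p) → FirstStepAvoids x p
  firstStepAvoids []            _             = tt
  firstStepAvoids (_ ∷ [])      (_ ∷ x≢w ∷ _) = ≢-sym x≢w
  firstStepAvoids (_ ∷ (_ ∷ _)) (_ ∷ x≢w ∷ _) = ≢-sym x≢w

  -- Going back up would revisit the vertex just left, so a path keeps descending once it has.
  descending : ∀ {x y z} (p : Walk G y z) → ChildOf y x → FirstStepAvoids x p → Unique (verts p) →
               depth x < depth z × parent z ≡ penultimate x p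
  descending []      (py , dy) _      _             = ≤-reflexive (sym dy) , py
  descending (e ∷ p) (py , dy) w≢x    (y∉p ∷ p-unique) with edge e
  ... | inj₁ (py′ , _) = ⊥-elim (w≢x (trans (sym py′) py))
  ... | inj₂ w-child with descending p w-child (firstStepAvoids p y∉p) p-unique
  ...   | y<z , pz = <-trans (≤-reflexive (sym dy)) y<z , pz

  noDeeper⊎descendsAtEnd : ∀ {y z} (p : Walk G y z) → Unique (verts p) → ∀ x →
                           depth z ≤ depth y ⊎ parent z ≡ penultimate x p
  noDeeper⊎descendsAtEnd []      _                  _ = inj₁ ≤-refl
  noDeeper⊎descendsAtEnd (e ∷ p) (y∉p ∷ p-unique)   _ with edge e
  ... | inj₂ w-child = inj₂ (proj₂ (descending p w-child (firstStepAvoids p y∉p) p-unique))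
  ... | inj₁ (_ , dy) with noDeeper⊎descendsAtEnd p p-unique _
  ...   | inj₁ z≤w = inj₁ (≤-trans z≤w (≤-trans (n≤1+n _) (≤-reflexive (sym dy))))
  ...   | inj₂ pz  = inj₂ pz

  acyclic : Acyclic G
  acyclic u []                     ()
  acyclic u (_ ∷ [])               (s≤s () , _)
  acyclic u (_ ∷ _ ∷ [])           (s≤s (s≤s ()) , _)
  acyclic u (_∷_ {w = v₁} e p@(_ ∷ (_ ∷ q))) (_ , p-unique@(v₁∉ ∷ v₂∉ ∷ _)) with edge e
  ... | inj₂ v₁-child =
    <-irrefl refl (proj₁ (descending p v₁-child (All.lookup v₂∉ (last∈verts q)) p-unique))
  ... | inj₁ (pu , du) with noDeeper⊎descendsAtEnd p p-unique u
  ...   | inj₁ u≤v₁ = 1+n≰n (≤-trans (≤-reflexive (sym du)) u≤v₁)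
  ...   | inj₂ pu′  = All.lookup v₁∉ (penultimate∈ _ q) (trans (sym pu) pu′)

module ParentTree {n : ℕ} {V : Set} (ι : Fin n ↔ V) (root : V) (parent : V → V) (depth : V → ℕ)
  (depth-parent : ∀ {x} → x ≢ root → depth x ≡ suc (depth (parent x)))
  where

  open Inverse ι public
    using () renaming (to to dec; from to enc; strictlyInverseˡ to dec-enc; strictlyInverseʳ to enc-dec)

  enc-injective : ∀ {x y} → enc x ≡ enc y → x ≡ y
  enc-injective = Injection.injective (↔⇒↣ (↔-sym ι))

  dec-injective : ∀ {u v} → dec u ≡ dec v → u ≡ v
  dec-injective = Injection.injective (↔⇒↣ ι)

  _≟ⱽ_ : DecidableEquality V
  _≟ⱽ_ = via-injection (↔⇒↣ (↔-sym ι)) _≟_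

  ChildOf : V → V → Set
  ChildOf x y = parent x ≡ y × depth x ≡ suc (depth y)

  Linked : V → V → Set
  Linked x y = ChildOf x y ⊎ ChildOf y x

  childOf? : ∀ x y → Dec (ChildOf x y)
  childOf? x y = (parent x ≟ⱽ y) ×-dec (depth x ℕ.≟ suc (depth y))

  linked? : ∀ x y → Dec (Linked x y)
  linked? x y = childOf? x y ⊎-dec childOf? y x

  ¬linked-self : ∀ x → ¬ Linked x x
  ¬linked-self x (inj₁ (_ , dx)) = 1+n≢n (sym dx)
  ¬linked-self x (inj₂ (_ , dx)) = 1+n≢n (sym dx)

  tree : Graph n
  tree = record
    { adj    = λ u v → does (linked? (dec u) (dec v))
    ; sym    = λ u v → ∨-comm (does (childOf? (dec u) (dec v))) (does (childOf? (dec v) (dec u)))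
    ; irrefl = λ u → dec-false (linked? (dec u) (dec u)) (¬linked-self (dec u))
    }

  adj⇒linked : ∀ {u v} → Adj tree u v → Linked (dec u) (dec v)
  adj⇒linked {u} {v} = toWitness ∘ subst T (sym (isYes≗does (linked? (dec u) (dec v))))

  enc-adj⇒linked : ∀ {x v} → Adj tree (enc x) v → Linked x (dec v)
  enc-adj⇒linked {x} {v} = subst (λ x′ → Linked x′ (dec v)) (dec-enc x) ∘ adj⇒linked

  linked⇒adj : ∀ {x y} → Linked x y → Adj tree (enc x) (enc y)
  linked⇒adj {x} {y} = subst T (isYes≗does (linked? (dec (enc x)) (dec (enc y)))) ∘ fromWitness
                     ∘ subst₂ Linked (sym (dec-enc x)) (sym (dec-enc y))

  toParent : ∀ x → x ≢ root → Adj tree (enc x) (enc (parent x))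
  toParent _ x≢root = linked⇒adj (inj₁ (refl , depth-parent x≢root))

  fromParent : ∀ x → x ≢ root → Adj tree (enc (parent x)) (enc x)
  fromParent _ x≢root = linked⇒adj (inj₂ (refl , depth-parent x≢root))

  ¬adj-of-depth : ∀ x y → depth x ≢ suc (depth y) → depth y ≢ suc (depth x) → ¬ Adj tree (enc x) (enc y)
  ¬adj-of-depth x y dx≢ dy≢ e with subst (Linked _) (dec-enc y) (enc-adj⇒linked e)
  ... | inj₁ (_ , dx) = dx≢ dx
  ... | inj₂ (_ , dy) = dy≢ dy

  sameDepth⇒¬adj : ∀ x y → depth x ≡ depth y → ¬ Adj tree (enc x) (enc y)
  sameDepth⇒¬adj x y dx≡dy =
    ¬adj-of-depth x y (λ dx → 1+n≢n (trans (sym dx) dx≡dy)) (λ dy → 1+n≢n (trans (sym dy) (sym dx≡dy)))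

  walkToRoot : ∀ m x → depth x ≡ m → Walk tree (enc x) (enc root)
  walkToRoot m x dx with x ≟ⱽ root
  ... | yes refl = []
  walkToRoot zero    x dx | no x≢root = contradiction (trans (sym (depth-parent x≢root)) dx) λ ()
  walkToRoot (suc m) x dx | no x≢root =
    toParent x x≢root ∷ walkToRoot m (parent x) (suc-injective (trans (sym (depth-parent x≢root)) dx))

  connected : Connected tree
  connected u v = subst₂ (Walk tree) (enc-dec u) (enc-dec v)
    (walkToRoot _ (dec u) refl ++ʷ reverseʷ (walkToRoot _ (dec v) refl))

  acyclic : Acyclic tree
  acyclic = ParentAcyclic.acyclic (enc ∘ parent ∘ dec) (depth ∘ dec) edge
    where
    edge : ∀ {u v} → Adj tree u v →
           (enc (parent (dec u)) ≡ v × depth (dec u) ≡ suc (depth (dec v))) ⊎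
           (enc (parent (dec v)) ≡ u × depth (dec v) ≡ suc (depth (dec u)))
    edge {u} {v} e with adj⇒linked e
    ... | inj₁ (pu , du) = inj₁ (trans (cong enc pu) (enc-dec v) , du)
    ... | inj₂ (pv , dv) = inj₂ (trans (cong enc pv) (enc-dec u) , dv)

  isTree : IsTree tree
  isTree = >-nonZero⁻¹ n {{nonZeroIndex (enc root)}} , connected , acyclic

-- Internal vertices and leaves live in separate types: parent lands in Internal, so leaves are
-- childless by typing, and the internal vertices are an initial segment of the numbering.
-- The pattern synonyms of Internal and of Leaf overlap (c and a are both inj₁ zero).
Internal Leaf Vertex : ℕ → Set
Internal k = Fin 1 ⊎ (Fin 3 × Fin k)
Leaf     k = Fin 1 ⊎ (Fin 2 × Fin k)
Vertex   k = Internal k ⊎ Leaf k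

pattern c    = inj₁ zero
pattern b  j = inj₂ (zero , j)
pattern d  j = inj₂ (suc zero , j)
pattern d′ j = inj₂ (suc (suc zero) , j)

pattern a    = inj₁ zero
pattern b′ j = inj₂ (zero , j)
pattern d″ j = inj₂ (suc zero , j)

pattern internal x = inj₁ x
pattern leaf     x = inj₂ x

module Construction (k : ℕ) (j₀ : Fin k) where

  parent : Vertex k → Internal k
  parent (internal c)      = c
  parent (internal (b _))  = c
  parent (internal (d _))  = c
  parent (internal (d′ j)) = d j
  parent (leaf a)          = c
  parent (leaf (b′ j))     = b j
  parent (leaf (d″ j))     = d′ j

  depth : Vertex k → ℕ
  depth (internal c)      = 0
  depth (internal (b _))  = 1
  depth (internal (d _))  = 1
  depth (internal (d′ _)) = 2
  depth (leaf a)          = 1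
  depth (leaf (b′ _))     = 2
  depth (leaf (d″ _))     = 3

  depth-parent : ∀ {x} → x ≢ internal c → depth x ≡ suc (depth (internal (parent x)))
  depth-parent {internal c}      c≢c = ⊥-elim (c≢c refl)
  depth-parent {internal (b _)}  _   = refl
  depth-parent {internal (d _)}  _   = refl
  depth-parent {internal (d′ _)} _   = refl
  depth-parent {leaf a}          _   = refl
  depth-parent {leaf (b′ _)}     _   = refl
  depth-parent {leaf (d″ _)}     _   = refl

  internalIso : Fin (1 + 3 * k) ↔ Internal k
  internalIso = ↔-trans +↔⊎ (↔-refl ⊎-↔ *↔×)

  leafIso : Fin (1 + 2 * k) ↔ Leaf k
  leafIso = ↔-trans +↔⊎ (↔-refl ⊎-↔ *↔×)

  N : ℕ
  N = (1 + 3 * k) + (1 + 2 * k)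

  open ParentTree {N} (↔-trans +↔⊎ (internalIso ⊎-↔ leafIso))
                   (internal c) (internal ∘ parent) depth depth-parent public

  internals : Subset N
  internals = full {1 + 3 * k} ++ empty {1 + 2 * k}

  enc-internal∈internals : ∀ y → enc (internal y) ∈ internals
  enc-internal∈internals y = ↑ˡ∈full++empty (1 + 2 * k) (Inverse.from internalIso y)

  internals-totalDominating : TotalDominating tree internals
  internals-totalDominating u =
    subst (λ u → ∃ λ v → v ∈ internals × Adj tree u v) (enc-dec u) (internalNeighbour (dec u))
    where
    internalNeighbour : ∀ x → ∃ λ v → v ∈ internals × Adj tree (enc x) v
    internalNeighbour x with x ≟ⱽ internal c
    ... | yes refl   =
      enc (internal (b j₀)) , enc-internal∈internals (b j₀) , fromParent (internal (b j₀)) λ ()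
    ... | no  x≢root =
      enc (internal (parent x)) , enc-internal∈internals (parent x) , toParent x x≢root

  privateChild : Internal k → Vertex k
  privateChild c      = leaf a
  privateChild (b j)  = leaf (b′ j)
  privateChild (d j)  = internal (d′ j)
  privateChild (d′ j) = leaf (d″ j)

  parent-privateChild : ∀ x → parent (privateChild x) ≡ x
  parent-privateChild c      = refl
  parent-privateChild (b _)  = refl
  parent-privateChild (d _)  = refl
  parent-privateChild (d′ _) = refl

  -- The leaves a and b′ j are adjacent to no private child; their owner is arbitrary.
  owner : Vertex k → Internal k
  owner (internal x)  = x
  owner (leaf (d″ j)) = d j
  owner (leaf _)      = c

  owner-child : ∀ x {y} → internal (parent y) ≡ privateChild x → owner y ≡ x
  owner-child c      ()
  owner-child (b _)  ()
  owner-child (d′ _) ()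
  owner-child (d _) {internal c}      ()
  owner-child (d _) {internal (b _)}  ()
  owner-child (d _) {internal (d _)}  ()
  owner-child (d _) {internal (d′ _)} ()
  owner-child (d _) {leaf a}          ()
  owner-child (d _) {leaf (b′ _)}     ()
  owner-child (d _) {leaf (d″ _)}     refl = refl

  owner-adj : ∀ x {z} → Adj tree (enc (privateChild x)) z → owner (dec z) ≡ x
  owner-adj x {z} e with enc-adj⇒linked {privateChild x} {z} e
  ... | inj₁ (p , _) = trans (cong owner (sym p)) (parent-privateChild x)
  ... | inj₂ (p , _) = owner-child x p

  privateChildren-openPacking : OpenPacking tree (enc ∘ privateChild)
  privateChildren-openPacking {x} {y} z ex ey = trans (sym (owner-adj x {z} ex)) (owner-adj y {z} ey)

  γₜ≡1+3k : IsTotalDomNum tree (1 + 3 * k)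
  γₜ≡1+3k = (internals , internals-totalDominating , ∣full++empty∣ _ _)
     , openPacking-size≤∣D∣ tree internalIso (enc ∘ privateChild) privateChildren-openPacking

  -- d j is adjacent to no leaf; its owner is arbitrary.
  leafOwner : Vertex k → Leaf k
  leafOwner (internal c)      = a
  leafOwner (internal (b j))  = b′ j
  leafOwner (internal (d _))  = a
  leafOwner (internal (d′ j)) = d″ j
  leafOwner (leaf ℓ)          = ℓ

  leafOwner-parent : ∀ ℓ → leafOwner (internal (parent (leaf ℓ))) ≡ ℓ
  leafOwner-parent a      = refl
  leafOwner-parent (b′ _) = refl
  leafOwner-parent (d″ _) = refl

  leafOwner-closedNbr : ∀ ℓ {z} → ClosedNbr tree (enc (leaf ℓ)) z → leafOwner (dec z) ≡ ℓ
  leafOwner-closedNbr ℓ (inj₁ refl) = cong leafOwner (dec-enc (leaf ℓ))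
  leafOwner-closedNbr ℓ {z} (inj₂ e) with enc-adj⇒linked {leaf ℓ} {z} e
  ... | inj₁ (p , _) = trans (cong leafOwner (sym p)) (leafOwner-parent ℓ)
  ... | inj₂ (p , _) = contradiction p λ ()

  leaves-packing : Packing tree (enc ∘ leaf)
  leaves-packing {x} {y} z x∼z y∼z = trans (sym (leafOwner-closedNbr x x∼z)) (leafOwner-closedNbr y y∼z)

  part : Vertex k → Leaf k
  part (internal c)      = b′ j₀
  part (internal (b _))  = a
  part (internal (d _))  = a
  part (internal (d′ j)) = d″ j
  part (leaf ℓ)          = ℓ

  colour : Fin N → Fin (1 + 2 * k)
  colour = Inverse.from leafIso ∘ part ∘ dec

  data Class : Leaf k → Vertex k → Set where
    a-leaf      : Class a (leaf a)
    b-internal  : ∀ {j} → Class a (internal (b j))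
    d-internal  : ∀ {j} → Class a (internal (d j))
    root        : Class (b′ j₀) (internal c)
    b′-leaf     : ∀ {j} → Class (b′ j) (leaf (b′ j))
    d′-internal : ∀ {j} → Class (d″ j) (internal (d′ j))
    d″-leaf     : ∀ {j} → Class (d″ j) (leaf (d″ j))

  class : ∀ x → Class (part x) x
  class (internal c)      = root
  class (internal (b _))  = b-internal
  class (internal (d _))  = d-internal
  class (internal (d′ _)) = d′-internal
  class (leaf a)          = a-leaf
  class (leaf (b′ _))     = b′-leaf
  class (leaf (d″ _))     = d″-leaf

  Visible : Fin N → Fin N → Set
  Visible u v = Σ (Walk tree u v) λ p → IsGeodesic p × len p ≤ 2 × All (λ w → colour w ≢ colour u) (inner p)

  visible-edge : ∀ x y → Adj tree (enc x) (enc y) → Visible (enc x) (enc y)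
  visible-edge _ _ e = e ∷ [] , edge-isGeodesic e , s≤s z≤n , []

  visible-via : ∀ x m y → Adj tree (enc x) (enc m) → Adj tree (enc m) (enc y) →
                x ≢ y → ¬ Adj tree (enc x) (enc y) → part m ≢ part x → Visible (enc x) (enc y)
  visible-via x m y e f x≢y x≁y m∉class =
    _∷_ {w = enc m} e (f ∷ []) ,
    twoStep-isGeodesic {w = enc m} (x≢y ∘ enc-injective) x≁y e f ,
    ≤-refl ,
    m∉class′ ∷ []
    where
    m∉class′ : colour (enc m) ≢ colour (enc x)
    m∉class′ = m∉class ∘ subst₂ (λ y z → part y ≡ part z) (dec-enc m) (dec-enc x)
             ∘ Injection.injective (↔⇒↣ (↔-sym leafIso))

  visible : ∀ {ℓ x y} → Class ℓ x → Class ℓ y → x ≢ y → Visible (enc x) (enc y)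
  visible {ℓ = a} {x} {y} x∈a y∈a x≢y =
    visible-via x (internal c) y (linked⇒adj (inj₁ x-child)) (linked⇒adj (inj₂ y-child)) x≢y
      (sameDepth⇒¬adj x y (trans (proj₂ x-child) (sym (proj₂ y-child))))
      (λ c∼x → contradiction (trans c∼x (part-a x∈a)) λ ())
    where
    childOfRoot : ∀ {x} → Class a x → ChildOf x (internal c)
    childOfRoot a-leaf     = refl , refl
    childOfRoot b-internal = refl , refl
    childOfRoot d-internal = refl , refl
    part-a : ∀ {x} → Class a x → part x ≡ a
    part-a a-leaf     = refl
    part-a b-internal = refl
    part-a d-internal = refl
    x-child : ChildOf x (internal c)
    x-child = childOfRoot x∈a
    y-child : ChildOf y (internal c)
    y-child = childOfRoot y∈a
  visible root root x≢y = ⊥-elim (x≢y refl)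
  visible root b′-leaf _ =
    visible-via (internal c) (internal (b j₀)) (leaf (b′ j₀))
      (fromParent (internal (b j₀)) λ ()) (fromParent (leaf (b′ j₀)) λ ()) (λ ())
      (¬adj-of-depth (internal c) (leaf (b′ j₀)) (λ ()) (λ ())) (λ ())
  visible b′-leaf root _ =
    visible-via (leaf (b′ j₀)) (internal (b j₀)) (internal c)
      (toParent (leaf (b′ j₀)) λ ()) (toParent (internal (b j₀)) λ ()) (λ ())
      (¬adj-of-depth (leaf (b′ j₀)) (internal c) (λ ()) (λ ())) (λ ())
  visible b′-leaf b′-leaf x≢y = ⊥-elim (x≢y refl)
  visible d′-internal d′-internal x≢y = ⊥-elim (x≢y refl)
  visible {x = x} {y} d′-internal d″-leaf _ = visible-edge x y (fromParent y λ ())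
  visible {x = x} {y} d″-leaf d′-internal _ = visible-edge x y (toParent x λ ())
  visible d″-leaf d″-leaf x≢y = ⊥-elim (x≢y refl)

  colourClass-isMV2 : ∀ i → IsMV2 tree (λ u → colour u ≡ i)
  colourClass-isMV2 _ u v refl v∼u u≢v =
    subst₂ Visible (enc-dec u) (enc-dec v)
      (visible (class (dec u)) (subst (λ ℓ → Class ℓ (dec v)) same-part (class (dec v)))
               (u≢v ∘ dec-injective))
    where
    same-part : part (dec v) ≡ part (dec u)
    same-part = Injection.injective (↔⇒↣ (↔-sym leafIso)) v∼u

  χμ₂≡1+2k : IsChiMu2 tree (1 + 2 * k)
  χμ₂≡1+2k = (colour , colourClass-isMV2) , λ _ → packing-size≤parts tree leafIso (enc ∘ leaf) leaves-packing

mainTheorem8 : ∀ (ℓ : ℕ) → 1 ≤ ℓ →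
    Σ ℕ λ n → Σ (Graph n) λ T → IsTree T ×
      Σ ℕ λ g → Σ ℕ λ c → IsTotalDomNum T g × IsChiMu2 T c × g ≡ c + ℓ
mainTheorem8 zero    ()
mainTheorem8 (suc k) _ =
  N , tree , isTree , 1 + 3 * suc k , 1 + 2 * suc k , γₜ≡1+3k , χμ₂≡1+2k ,
  cong suc (+-comm (suc k) (2 * suc k))
  where open Construction (suc k) zero
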